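{- Let $G=(V,E)$ be a finite simple graph of order $n$ and size $m$, with maximum degree $\Delta$ and minimum degree $\delta$. Then for every integer $k\geq 2$, $$2m(k-2)\sqrt{2}+ n\delta\sqrt{\delta^2+4}\leq SO(G^{\frac{1}{k}}) \leq 2m(k-2)\sqrt{2}+ n\Delta\sqrt{\Delta^2+4},$$ where $SO(H)=\sum_{xy\in E(H)}\sqrt{d_x(H)^2+d_y(H)^2}$ is the Sombor index.
   Context: For $k\in\mathbb{N}$, the $k$-subdivision $G^{\frac1k}$ of $G$ is the simple graph obtained by replacing each edge of $G$ with a path of length $k$. -}

module Defs where

open import Data.Nat using (ℕ; zero; suc; _+_; _*_; _≤_; _<_; _<?_; _≤?_)
open import Data.Nat.Properties using () renaming (_≟_ to _≟ℕ_)
open import Data.Bool using (Bool; true; false; T; if_then_else_)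
open import Data.Fin using (Fin; zero; suc; toℕ; inject₁; fromℕ)
open import Data.Fin.Properties using () renaming (_≟_ to _≟F_)
open import Data.List using (List; []; _∷_; _++_; map; length; filter; filterᵇ; cartesianProduct; allFin; upTo; lookup; concat)
open import Data.Nat.ListAction using (sum)
open import Data.Product using (_×_; _,_; ∃)
open import Relation.Nullary using (Dec; yes; no; does)
open import Relation.Nullary.Decidable using (_×-dec_; _⊎-dec_; T?)
open import Relation.Binary.PropositionalEquality using (_≡_; refl; cong)

record Graph (n : ℕ) : Set where
  field
    adj    : Fin n → Fin n → Bool
    sym    : ∀ i j → adj i j ≡ adj j i
    irrefl : ∀ i → adj i i ≡ false
open Graph public

edges : ∀ {n} → Graph n → List (Fin n × Fin n)
edges {n} G = filter (λ { (i , j) → (toℕ i <? toℕ j) ×-dec T? (adj G i j) })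
                     (cartesianProduct (allFin n) (allFin n))

size : ∀ {n} → Graph n → ℕ
size G = length (edges G)

degree : ∀ {n} → Graph n → Fin n → ℕ
degree {n} G v = length (filterᵇ (adj G v) (allFin n))

IsMaxDegree : ∀ {n} → Graph n → ℕ → Set
IsMaxDegree G Δ = (∃ λ v → degree G v ≡ Δ) × (∀ v → degree G v ≤ Δ)

IsMinDegree : ∀ {n} → Graph n → ℕ → Set
IsMinDegree G δ = (∃ λ v → degree G v ≡ δ) × (∀ v → δ ≤ degree G v)

-- The k-subdivision G^{1/k}. Vertices: original vertices, plus for each
-- edge e (indexed by Fin m) its k-1 internal path vertices mid e 0 .. mid e (k-2).

data SubV (n m k : ℕ) : Set where
  orig : Fin n → SubV n m k
  mid  : Fin m → Fin (k Data.Nat.∸ 1) → SubV n m k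

_≟V_ : ∀ {n m k} → (x y : SubV n m k) → Dec (x ≡ y)
orig i ≟V orig j with i ≟F j
... | yes refl = yes refl
... | no ne = no λ { refl → ne refl }
orig i ≟V mid e t = no λ ()
mid e t ≟V orig i = no λ ()
mid e t ≟V mid f s with e ≟F f | t ≟F s
... | yes refl | yes refl = yes refl
... | no ne | _ = no λ { refl → ne refl }
... | yes _ | no ne = no λ { refl → ne refl }

pathEdges : ∀ {n m} (k : ℕ) → Fin m → Fin n → Fin n → List (SubV n m k × SubV n m k)
pathEdges zero e u v = []      -- k = 0 is not used
pathEdges (suc zero) e u v = (orig u , orig v) ∷ []
pathEdges (suc (suc j)) e u v =
  (orig u , mid e zero)
  ∷ (map (λ (i : Fin j) → (mid e (inject₁ i) , mid e (suc i))) (allFin j)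
     ++ ((mid e (fromℕ j) , orig v) ∷ []))

subdivEdges : ∀ {n} (G : Graph n) (k : ℕ) → List (SubV n (size G) k × SubV n (size G) k)
subdivEdges G k = concat (map f (allFin (size G)))
  where
    f : Fin (size G) → List _
    f e with lookup (edges G) e
    ... | (u , v) = pathEdges k e u v

-- A finite graph given by a vertex type with decidable equality and its
-- edge list (each edge once); degrees and the Sombor index.

degIn : ∀ {V : Set} → ((x y : V) → Dec (x ≡ y)) → List (V × V) → V → ℕ
degIn _≟_ E x = length (filter (λ { (a , b) → (x ≟ a) ⊎-dec (x ≟ b) }) E)

-- A nonnegative real of the form Σ_{a ∈ xs} √a is represented by the
-- list xs of its radicands ("SqrtSum").
SqrtSum : Set
SqrtSum = List ℕ

sombor : ∀ {V : Set} → ((x y : V) → Dec (x ≡ y)) → List (V × V) → SqrtSum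
sombor _≟_ E = map (λ { (a , b) → d a * d a + d b * d b }) E
  where d = degIn _≟_ E

somborSubdiv : ∀ {n} → Graph n → ℕ → SqrtSum
somborSubdiv G k = sombor _≟V_ (subdivEdges G k)

-- Real order on SqrtSums, via exact integer arithmetic.
-- isqrt a = ⌊√a⌋,  csqrt a = ⌈√a⌉.

isqrt : ℕ → ℕ
isqrt a = length (filter (λ s → s * s ≤? a) (map suc (upTo a)))

csqrt : ℕ → ℕ
csqrt a = if does (isqrt a * isqrt a ≟ℕ a) then isqrt a else suc (isqrt a)

-- For N ≥ 0:  lowerApprox xs N ≤ N·Σ√a ≤ upperApprox xs N, with errors ≤ |xs|.
lowerApprox : SqrtSum → ℕ → ℕ
lowerApprox xs N = sum (map (λ a → isqrt (a * (N * N))) xs)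

upperApprox : SqrtSum → ℕ → ℕ
upperApprox xs N = sum (map (λ a → csqrt (a * (N * N))) xs)

-- Σ_{a∈xs} √a ≤ Σ_{b∈ys} √b  (as real numbers) iff for every N,
-- Σ ⌊N√a⌋ ≤ Σ ⌈N√b⌉.
infix 4 _≤√_
_≤√_ : SqrtSum → SqrtSum → Set
xs ≤√ ys = ∀ (N : ℕ) → lowerApprox xs N ≤ upperApprox ys N

_·√_ : ℕ → ℕ → SqrtSum
c ·√ a = Data.List.replicate c a

-- Every subdivision vertex of G^{1/k} has degree 2 and every original vertex keeps its degree.
-- So each edge uv of G becomes a path with k - 2 inner edges of weight √8 = 2√2 and two end
-- edges of weights √(d_u² + 4) and √(d_v² + 4). Summing over the edges with the weighted
-- handshake identity Σ_{uv ∈ E} (f u + f v) = Σ_x d_x f x gives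
-- SO(G^{1/k}) = 2m(k - 2)√2 + Σ_x d_x √(d_x² + 4), and δ ≤ d_x ≤ Δ bounds the last sum.
-- The comparisons of square-root sums are checked on the approximations ⌊N√a⌋ and ⌈N√a⌉,
-- where 2⌊N√2⌋ ≤ ⌈N√8⌉ and ⌊N√8⌋ ≤ 2⌈N√2⌉ replace √8 = 2√2.

module Submission where

open import Defs hiding (sym)
open import Data.Nat using (ℕ; zero; suc; _+_; _*_; _∸_; _≤_; z≤n; s≤s; _<?_; _≤?_)
open import Data.List using (List; []; _∷_; _++_; map; length; filter; concat; allFin; tabulate; upTo; lookup; replicate; cartesianProduct)
open import Data.Product using (_×_; _,_; proj₁; proj₂)

open import Data.Bool using (Bool; true; false; _∨_; _∧_; if_then_else_)
open import Data.Bool.Properties using (∨-identityʳ)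
open import Data.Fin using (Fin; zero; suc; toℕ; inject₁; fromℕ; punchIn)
open import Data.Fin.Properties using (toℕ-injective; punchInᵢ≢i) renaming (_≟_ to _≟F_)
open import Data.List.Properties using (upTo-∷ʳ; map-++; map-∘; map-cong; map-tabulate)
open import Data.Nat.ListAction using (sum)
open import Data.Nat.ListAction.Properties using (sum-++)
open import Data.Nat.Properties
open import Data.Nat.Tactic.RingSolver using (solve-∀)
open import Data.Sum using (inj₁; inj₂)
open import Function using (_∘_; id; mk⇔)
open import Relation.Binary using (tri<; tri≈; tri>)
open import Relation.Binary.PropositionalEquality
open import Relation.Nullary using (Dec; yes; no; does; ¬_; contradiction)
open import Relation.Nullary.Decidable using (dec-true; dec-false; does-⇔)
open import Relation.Unary using (Decidable)
open import Algebra.Properties.CommutativeSemigroup +-commutativeSemigroup using (x∙yz≈y∙xz)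
open import Algebra.Properties.Semiring.Sum +-*-semiring
  using (sum-syntax; sum-cong-≗; sum-remove; sum-replicate-zero; ∑-distrib-+; ∑-comm; *-distribʳ-sum)
  renaming (sum to ∑)

𝟙 : Bool → ℕ
𝟙 true  = 1
𝟙 false = 0

module _ {A : Set} where

  sum-map-++ : (g : A → ℕ) (xs ys : List A) → sum (map g (xs ++ ys)) ≡ sum (map g xs) + sum (map g ys)
  sum-map-++ g xs ys = trans (cong sum (map-++ g xs ys)) (sum-++ (map g xs) (map g ys))

  sum-map-concat : (g : A → ℕ) (xss : List (List A)) →
                   sum (map g (concat xss)) ≡ sum (map (λ xs → sum (map g xs)) xss)
  sum-map-concat g []         = refl
  sum-map-concat g (xs ∷ xss) = trans (sum-map-++ g xs (concat xss)) (cong (sum (map g xs) +_) (sum-map-concat g xss))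

  sum-map-replicate : (g : A → ℕ) (c : ℕ) (x : A) → sum (map g (replicate c x)) ≡ c * g x
  sum-map-replicate g zero    x = refl
  sum-map-replicate g (suc c) x = cong (g x +_) (sum-map-replicate g c x)

  sum-map-filter : {P : A → Set} (P? : Decidable P) (g : A → ℕ) (xs : List A) →
                   sum (map g (filter P? xs)) ≡ sum (map (λ x → 𝟙 (does (P? x)) * g x) xs)
  sum-map-filter P? g []       = refl
  sum-map-filter P? g (x ∷ xs) with does (P? x)
  ... | true  = cong₂ _+_ (sym (+-identityʳ (g x))) (sum-map-filter P? g xs)
  ... | false = sum-map-filter P? g xs

  length-filter : {P : A → Set} (P? : Decidable P) (xs : List A) →
                  length (filter P? xs) ≡ sum (map (λ x → 𝟙 (does (P? x))) xs)
  length-filter P? []       = refl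
  length-filter P? (x ∷ xs) with does (P? x)
  ... | true  = cong suc (length-filter P? xs)
  ... | false = length-filter P? xs

  sum-map-lookup : (g : A → ℕ) (xs : List A) → ∑ (g ∘ lookup xs) ≡ sum (map g xs)
  sum-map-lookup g []       = refl
  sum-map-lookup g (x ∷ xs) = cong (g x +_) (sum-map-lookup g xs)

sum-map-cartesianProduct : {A B : Set} (g : A × B → ℕ) (xs : List A) (ys : List B) →
  sum (map g (cartesianProduct xs ys)) ≡ sum (map (λ x → sum (map (λ y → g (x , y)) ys)) xs)
sum-map-cartesianProduct g []       ys = refl
sum-map-cartesianProduct g (x ∷ xs) ys =
  trans (sum-map-++ g (map (x ,_) ys) _)
        (cong₂ _+_ (cong sum (sym (map-∘ ys))) (sum-map-cartesianProduct g xs ys))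

sum-tabulate : ∀ {m} (g : Fin m → ℕ) → sum (tabulate g) ≡ ∑ g
sum-tabulate {zero}  g = refl
sum-tabulate {suc m} g = cong (g zero +_) (sum-tabulate (g ∘ suc))

sum-map-allFin : ∀ {m} (g : Fin m → ℕ) → sum (map g (allFin m)) ≡ ∑ g
sum-map-allFin g = trans (cong sum (map-tabulate id g)) (sum-tabulate g)

∑-mono-≤ : ∀ {m} {f g : Fin m → ℕ} → (∀ i → f i ≤ g i) → ∑ f ≤ ∑ g
∑-mono-≤ {zero}  f≤g = z≤n
∑-mono-≤ {suc m} f≤g = +-mono-≤ (f≤g zero) (∑-mono-≤ (f≤g ∘ suc))

∑-const : ∀ m c → ∑[ i < m ] c ≡ m * c
∑-const zero    c = refl
∑-const (suc m) c = cong (c +_) (∑-const m c)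

∑-delta : ∀ {m} (x : Fin m) {g : Fin m → ℕ} → (∀ i → i ≢ x → g i ≡ 0) → ∑ g ≡ g x
∑-delta {suc m} x {g} vanish = begin
  ∑ g                          ≡⟨ sum-remove {i = x} g ⟩
  g x + ∑ (g ∘ punchIn x)      ≡⟨ cong (g x +_) (sum-cong-≗ (λ i → vanish _ (punchInᵢ≢i x i))) ⟩
  g x + ∑[ i < m ] 0           ≡⟨ cong (g x +_) (sum-replicate-zero m) ⟩
  g x + 0                      ≡⟨ +-identityʳ (g x) ⟩
  g x                          ∎
  where open ≡-Reasoning

∑-indicator : ∀ {m} (x : Fin m) (g : Fin m → ℕ) → ∑[ y < m ] (g y * 𝟙 (does (x ≟F y))) ≡ g x
∑-indicator x g = trans (∑-delta x (λ y y≢x → trans (cong (λ b → g y * 𝟙 b) (dec-false (x ≟F y) (y≢x ∘ sym))) (*-zeroʳ (g y))))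
                        (trans (cong (λ b → g x * 𝟙 b) (dec-true (x ≟F x) refl)) (*-identityʳ (g x)))

-- For downward closed P, count P? b is the largest s ≤ b satisfying P (or 0).
count : {P : ℕ → Set} → Decidable P → ℕ → ℕ
count P? b = length (filter P? (map suc (upTo b)))

module _ {P : ℕ → Set} (P? : Decidable P) where

  count-suc : ∀ b → count P? (suc b) ≡ count P? b + 𝟙 (does (P? (suc b)))
  count-suc b = begin
    count P? (suc b)                             ≡⟨ length-filter P? (map suc (upTo (suc b))) ⟩
    sum (map #P (map suc (upTo (suc b))))        ≡⟨ cong (λ xs → sum (map #P (map suc xs))) (upTo-∷ʳ b) ⟨
    sum (map #P (map suc (upTo b ++ b ∷ [])))    ≡⟨ cong (sum ∘ map #P) (map-++ suc (upTo b) (b ∷ [])) ⟩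
    sum (map #P (map suc (upTo b) ++ suc b ∷ [])) ≡⟨ sum-map-++ #P (map suc (upTo b)) (suc b ∷ []) ⟩
    sum (map #P (map suc (upTo b))) + (#P (suc b) + 0)
        ≡⟨ cong₂ _+_ (length-filter P? (map suc (upTo b))) (sym (+-identityʳ (#P (suc b)))) ⟨
    count P? b + #P (suc b)                      ∎
    where
    open ≡-Reasoning
    #P : ℕ → ℕ
    #P s = 𝟙 (does (P? s))

  count-yes : ∀ {b} → P (suc b) → count P? (suc b) ≡ suc (count P? b)
  count-yes {b} p = trans (count-suc b) (trans (cong (λ t → count P? b + 𝟙 t) (dec-true (P? (suc b)) p)) (+-comm _ 1))

  count-no : ∀ {b} → ¬ P (suc b) → count P? (suc b) ≡ count P? b
  count-no {b} ¬p = trans (count-suc b) (trans (cong (λ t → count P? b + 𝟙 t) (dec-false (P? (suc b)) ¬p)) (+-identityʳ _))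

  count≤ : ∀ b → count P? b ≤ b
  count≤ zero = z≤n
  count≤ (suc b) with P? (suc b)
  ... | yes p = subst (_≤ suc b) (sym (count-yes p)) (s≤s (count≤ b))
  ... | no ¬p = subst (_≤ suc b) (sym (count-no ¬p)) (m≤n⇒m≤1+n (count≤ b))

  count-mono : ∀ b → count P? b ≤ count P? (suc b)
  count-mono b = subst (count P? b ≤_) (sym (count-suc b)) (m≤m+n _ _)

  module _ (P-pred : ∀ s → P (suc s) → P s) where

    ≤count : ∀ {s b} → P s → s ≤ b → s ≤ count P? b
    ≤count {b = zero}  _  z≤n = z≤n
    ≤count {s} {suc b} Ps s≤1+b with m≤n⇒m<n∨m≡n s≤1+b
    ... | inj₁ (s≤s s≤b) = ≤-trans (≤count Ps s≤b) (count-mono b)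
    ... | inj₂ refl      = subst (suc b ≤_) (sym (count-yes Ps)) (s≤s (≤count (P-pred b Ps) ≤-refl))

    P-count : P 0 → ∀ b → P (count P? b)
    P-count P0 zero = P0
    P-count P0 (suc b) with P? (suc b)
    ... | yes p  = subst P (sym (trans (count-yes p) (cong suc count≡b))) p
      where
      count≡b : count P? b ≡ b
      count≡b = ≤-antisym (count≤ b) (≤count (P-pred b p) ≤-refl)
    ... | no ¬p = subst P (sym (count-no ¬p)) (P-count P0 b)

n≤n*n : ∀ n → n ≤ n * n
n≤n*n zero    = z≤n
n≤n*n (suc n) = m≤m*n (suc n) (suc n)

square-cancel-≤ : ∀ {x y} → x * x ≤ y * y → x ≤ y
square-cancel-≤ {x} {y} x²≤y² with x ≤? y
... | yes x≤y = x≤y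
... | no  x≰y = contradiction x²≤y² (<⇒≱ (*-mono-< (≰⇒> x≰y) (≰⇒> x≰y)))

square-pred : ∀ {a} s → suc s * suc s ≤ a → s * s ≤ a
square-pred s = ≤-trans (*-mono-≤ (n≤1+n s) (n≤1+n s))

isqrt-square≤ : ∀ a → isqrt a * isqrt a ≤ a
isqrt-square≤ a = P-count (λ s → s * s ≤? a) square-pred z≤n a

≤isqrt : ∀ {a s} → s * s ≤ a → s ≤ isqrt a
≤isqrt {a} {s} s²≤a = ≤count (λ s → s * s ≤? a) square-pred s²≤a (≤-trans (n≤n*n s) s²≤a)

isqrt-mono-≤ : ∀ {a b} → a ≤ b → isqrt a ≤ isqrt b
isqrt-mono-≤ {a} a≤b = ≤isqrt (≤-trans (isqrt-square≤ a) a≤b)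

isqrt≤csqrt : ∀ a → isqrt a ≤ csqrt a
isqrt≤csqrt a = ≤-if (does (isqrt a * isqrt a ≟ a))
  where
  ≤-if : (b : Bool) → isqrt a ≤ (if b then isqrt a else suc (isqrt a))
  ≤-if true  = ≤-refl
  ≤-if false = n≤1+n (isqrt a)

≤csqrt-square : ∀ a → a ≤ csqrt a * csqrt a
≤csqrt-square a = ≤-if-square (isqrt a * isqrt a ≟ a)
  where
  r : ℕ
  r = isqrt a
  ≤-if-square : (d : Dec (r * r ≡ a)) → a ≤ (if does d then r else suc r) * (if does d then r else suc r)
  ≤-if-square (yes r²≡a) = ≤-reflexive (sym r²≡a)
  ≤-if-square (no _)     = <⇒≤ (≰⇒> (λ [r+1]²≤a → 1+n≰n (≤isqrt [r+1]²≤a)))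

⌊_√_⌋ : ℕ → ℕ → ℕ
⌊ N √ a ⌋ = isqrt (a * (N * N))

⌈_√_⌉ : ℕ → ℕ → ℕ
⌈ N √ a ⌉ = csqrt (a * (N * N))

⌊√⌋≤⌈√⌉ : ∀ N {a b} → a ≤ b → ⌊ N √ a ⌋ ≤ ⌈ N √ b ⌉
⌊√⌋≤⌈√⌉ N {b = b} a≤b = ≤-trans (isqrt-mono-≤ (*-monoˡ-≤ (N * N) a≤b)) (isqrt≤csqrt (b * (N * N)))

*-⌊√⌋≤⌊√⌋ : ∀ N s a → s * ⌊ N √ a ⌋ ≤ ⌊ N √ (s * s * a) ⌋
*-⌊√⌋≤⌊√⌋ N s a = ≤isqrt (begin
  (s * l) * (s * l)         ≡⟨ [m*n]*[o*p]≡[m*o]*[n*p] s l s l ⟩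
  (s * s) * (l * l)         ≤⟨ *-monoʳ-≤ (s * s) (isqrt-square≤ (a * (N * N))) ⟩
  (s * s) * (a * (N * N))   ≡⟨ *-assoc (s * s) a (N * N) ⟨
  s * s * a * (N * N)       ∎)
  where
  open ≤-Reasoning
  l : ℕ
  l = ⌊ N √ a ⌋

⌊√⌋≤*-⌈√⌉ : ∀ N s a → ⌊ N √ (s * s * a) ⌋ ≤ s * ⌈ N √ a ⌉
⌊√⌋≤*-⌈√⌉ N s a = square-cancel-≤ (begin
  ⌊ N √ (s * s * a) ⌋ * ⌊ N √ (s * s * a) ⌋  ≤⟨ isqrt-square≤ (s * s * a * (N * N)) ⟩
  s * s * a * (N * N)                         ≡⟨ *-assoc (s * s) a (N * N) ⟩
  (s * s) * (a * (N * N))                     ≤⟨ *-monoʳ-≤ (s * s) (≤csqrt-square (a * (N * N))) ⟩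
  (s * s) * (u * u)                           ≡⟨ [m*n]*[o*p]≡[m*o]*[n*p] s s u u ⟩
  (s * u) * (s * u)                           ∎)
  where
  open ≤-Reasoning
  u : ℕ
  u = ⌈ N √ a ⌉

sum-map-·√-++ : (φ : ℕ → ℕ) (c a d b : ℕ) → sum (map φ ((c ·√ a) ++ (d ·√ b))) ≡ c * φ a + d * φ b
sum-map-·√-++ φ c a d b =
  trans (sum-map-++ φ (c ·√ a) (d ·√ b)) (cong₂ _+_ (sum-map-replicate φ c a) (sum-map-replicate φ d b))

∑-symmetrize : ∀ {n} (A : Fin n → Fin n → ℕ) (f : Fin n → ℕ) →
  ∑[ i < n ] ∑[ j < n ] (A i j * (f i + f j)) ≡ ∑[ i < n ] ∑[ j < n ] ((A i j + A j i) * f i)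
∑-symmetrize {n} A f = begin
  ∑[ i < n ] ∑[ j < n ] (A i j * (f i + f j))
    ≡⟨ sum-cong-≗ (λ i → trans (sum-cong-≗ (λ j → *-distribˡ-+ (A i j) (f i) (f j))) (∑-distrib-+ (λ j → A i j * f i) (λ j → A i j * f j))) ⟩
  ∑[ i < n ] (∑[ j < n ] (A i j * f i) + ∑[ j < n ] (A i j * f j))
    ≡⟨ ∑-distrib-+ (λ i → ∑[ j < n ] (A i j * f i)) (λ i → ∑[ j < n ] (A i j * f j)) ⟩
  ∑[ i < n ] ∑[ j < n ] (A i j * f i) + ∑[ i < n ] ∑[ j < n ] (A i j * f j)
    ≡⟨ cong (∑[ i < n ] ∑[ j < n ] (A i j * f i) +_) (∑-comm (λ i j → A i j * f j)) ⟩
  ∑[ i < n ] ∑[ j < n ] (A i j * f i) + ∑[ i < n ] ∑[ j < n ] (A j i * f i)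
    ≡⟨ ∑-distrib-+ (λ i → ∑[ j < n ] (A i j * f i)) (λ i → ∑[ j < n ] (A j i * f i)) ⟨
  ∑[ i < n ] (∑[ j < n ] (A i j * f i) + ∑[ j < n ] (A j i * f i))
    ≡⟨ sum-cong-≗ (λ i → trans (sum-cong-≗ (λ j → *-distribʳ-+ (f i) (A i j) (A j i))) (∑-distrib-+ (λ j → A i j * f i) (λ j → A j i * f i))) ⟨
  ∑[ i < n ] ∑[ j < n ] ((A i j + A j i) * f i)
    ∎
  where open ≡-Reasoning

module _ {n} (G : Graph n) where

  degree≡∑ : ∀ x → degree G x ≡ ∑[ y < n ] 𝟙 (adj G x y)
  degree≡∑ x = trans (length-filter _ (allFin n)) (sum-map-allFin (λ y → 𝟙 (adj G x y)))

  precedes : Fin n → Fin n → ℕ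
  precedes i j = 𝟙 (does (toℕ i <? toℕ j) ∧ adj G i j)

  precedes-sym : ∀ i j → precedes i j + precedes j i ≡ 𝟙 (adj G i j)
  precedes-sym i j with <-cmp (toℕ i) (toℕ j)
  ... | tri< i<j _ i≯j
    rewrite dec-true (toℕ i <? toℕ j) i<j | dec-false (toℕ j <? toℕ i) i≯j = +-identityʳ _
  ... | tri> i≮j _ i>j
    rewrite dec-false (toℕ i <? toℕ j) i≮j | dec-true (toℕ j <? toℕ i) i>j = cong 𝟙 (Graph.sym G j i)
  ... | tri≈ i≮j i≡j _ with refl ← toℕ-injective i≡j
    rewrite dec-false (toℕ i <? toℕ i) i≮j = cong 𝟙 (sym (irrefl G i))

  sum-map-edges : (f : Fin n → ℕ) → sum (map (λ (u , v) → f u + f v) (edges G)) ≡ ∑[ x < n ] (degree G x * f x)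
  sum-map-edges f = begin
    sum (map (λ (u , v) → f u + f v) (edges G))
      ≡⟨ sum-map-filter _ (λ (u , v) → f u + f v) (cartesianProduct (allFin n) (allFin n)) ⟩
    sum (map (λ (u , v) → precedes u v * (f u + f v)) (cartesianProduct (allFin n) (allFin n)))
      ≡⟨ sum-map-cartesianProduct (λ (u , v) → precedes u v * (f u + f v)) (allFin n) (allFin n) ⟩
    sum (map (λ u → sum (map (λ v → precedes u v * (f u + f v)) (allFin n))) (allFin n))
      ≡⟨ trans (cong sum (map-cong (λ u → sum-map-allFin (λ v → precedes u v * (f u + f v))) (allFin n)))
                (sum-map-allFin (λ u → ∑[ v < n ] (precedes u v * (f u + f v)))) ⟩
    ∑[ i < n ] ∑[ j < n ] (precedes i j * (f i + f j))
      ≡⟨ ∑-symmetrize precedes f ⟩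
    ∑[ i < n ] ∑[ j < n ] ((precedes i j + precedes j i) * f i)
      ≡⟨ sum-cong-≗ (λ i → sum-cong-≗ (λ j → cong (_* f i) (precedes-sym i j))) ⟩
    ∑[ i < n ] ∑[ j < n ] (𝟙 (adj G i j) * f i)
      ≡⟨ sum-cong-≗ (λ i → trans (cong (_* f i) (degree≡∑ i)) (*-distribʳ-sum (f i) (λ j → 𝟙 (adj G i j)))) ⟨
    ∑[ x < n ] (degree G x * f x)
      ∎
    where open ≡-Reasoning

path-interior-degree : ∀ j (t : Fin (suc j)) →
  𝟙 (does (t ≟F zero)) + (∑[ i < j ] 𝟙 (does (t ≟F inject₁ i) ∨ does (t ≟F suc i)) + 𝟙 (does (t ≟F fromℕ j))) ≡ 2
path-interior-degree zero    zero    = refl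
path-interior-degree (suc j) zero    = cong (λ z → 2 + (z + 0)) (sum-replicate-zero j)
path-interior-degree (suc j) (suc t) = trans (+-assoc (𝟙 (does (t ≟F zero))) _ _) (path-interior-degree j t)

module Subdivision {n} (G : Graph n) (j : ℕ) where

  m : ℕ
  m = size G

  Vertex : Set
  Vertex = SubV n m (suc (suc j))

  ends : Fin m → Fin n × Fin n
  ends = lookup (edges G)

  path : Fin m → List (Vertex × Vertex)
  path e = pathEdges (suc (suc j)) e (proj₁ (ends e)) (proj₂ (ends e))

  deg : Vertex → ℕ
  deg = degIn _≟V_ (subdivEdges G (suc (suc j)))

  sum-map-subdivEdges : (g : Vertex × Vertex → ℕ) →
                        sum (map g (subdivEdges G (suc (suc j)))) ≡ ∑[ e < m ] sum (map g (path e))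
  sum-map-subdivEdges g =
    trans (sum-map-concat g (map path (allFin m)))
          (trans (cong sum (sym (map-∘ (allFin m)))) (sum-map-allFin (λ e → sum (map g (path e)))))

  sum-map-path : (g : Vertex × Vertex → ℕ) (e : Fin m) → sum (map g (path e)) ≡
    g (orig (proj₁ (ends e)) , mid e zero)
      + (∑[ i < j ] g (mid e (inject₁ i) , mid e (suc i)) + g (mid e (fromℕ j) , orig (proj₂ (ends e))))
  sum-map-path g e = cong (g (orig (proj₁ (ends e)) , mid e zero) +_)
    (trans (sum-map-++ g (map interior (allFin j)) _)
           (cong₂ _+_ (trans (cong sum (sym (map-∘ (allFin j)))) (sum-map-allFin (g ∘ interior))) (+-identityʳ _)))
    where
    interior : Fin j → Vertex × Vertex
    interior i = mid e (inject₁ i) , mid e (suc i)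

  incidence : Vertex → Vertex × Vertex → ℕ
  incidence x (a , b) = 𝟙 (does (x ≟V a) ∨ does (x ≟V b))

  deg≡∑ : ∀ x → deg x ≡ ∑[ e < m ] sum (map (incidence x) (path e))
  deg≡∑ x = trans (length-filter _ (subdivEdges G (suc (suc j)))) (sum-map-subdivEdges (incidence x))

  does-orig≟orig : (x y : Fin n) → does (orig {m = m} {k = suc (suc j)} x ≟V orig y) ≡ does (x ≟F y)
  does-orig≟orig x y = does-⇔ (mk⇔ (λ { refl → refl }) (cong orig)) (orig x ≟V orig y) (x ≟F y)

  does-mid≟mid : (e : Fin m) (t s : Fin (suc j)) → does (mid {n = n} {k = suc (suc j)} e t ≟V mid e s) ≡ does (t ≟F s)
  does-mid≟mid e t s = does-⇔ (mk⇔ (λ { refl → refl }) (cong (mid e))) (mid e t ≟V mid e s) (t ≟F s)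

  incidence-orig-path : ∀ y e → sum (map (incidence (orig y)) (path e))
                                ≡ 𝟙 (does (y ≟F proj₁ (ends e))) + 𝟙 (does (y ≟F proj₂ (ends e)))
  incidence-orig-path y e = trans (sum-map-path (incidence (orig y)) e)
    (cong₂ _+_ (cong 𝟙 (trans (∨-identityʳ _) (does-orig≟orig y (proj₁ (ends e)))))
               (cong₂ _+_ (sum-replicate-zero j) (cong 𝟙 (does-orig≟orig y (proj₂ (ends e))))))

  deg-orig : ∀ y → deg (orig y) ≡ degree G y
  deg-orig y = begin
    deg (orig y)                                              ≡⟨ deg≡∑ (orig y) ⟩
    ∑[ e < m ] sum (map (incidence (orig y)) (path e))        ≡⟨ sum-cong-≗ (incidence-orig-path y) ⟩
    ∑[ e < m ] (δ (proj₁ (ends e)) + δ (proj₂ (ends e)))      ≡⟨ sum-map-lookup (λ (u , v) → δ u + δ v) (edges G) ⟩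
    sum (map (λ (u , v) → δ u + δ v) (edges G))               ≡⟨ sum-map-edges G δ ⟩
    ∑[ x < n ] (degree G x * δ x)                             ≡⟨ ∑-indicator y (degree G) ⟩
    degree G y                                                ∎
    where
    open ≡-Reasoning
    δ : Fin n → ℕ
    δ x = 𝟙 (does (y ≟F x))

  incidence-mid-own-path : ∀ e t → sum (map (incidence (mid e t)) (path e)) ≡ 2
  incidence-mid-own-path e t = trans (sum-map-path (incidence (mid e t)) e)
    (trans (cong₂ _+_ (cong 𝟙 (does-mid≟mid e t zero))
                      (cong₂ _+_ (sum-cong-≗ (λ i → cong₂ (λ b c → 𝟙 (b ∨ c)) (does-mid≟mid e t (inject₁ i)) (does-mid≟mid e t (suc i))))
                                 (cong 𝟙 (trans (∨-identityʳ _) (does-mid≟mid e t (fromℕ j))))))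
           (path-interior-degree j t))

  incidence-mid-other-path : ∀ {e e′} t → e′ ≢ e → sum (map (incidence (mid e t)) (path e′)) ≡ 0
  incidence-mid-other-path {e} {e′} t e′≢e = trans (sum-map-path (incidence (mid e t)) e′)
    (cong₂ _+_ (cong 𝟙 (≢mid zero))
               (cong₂ _+_ (trans (sum-cong-≗ (λ i → cong₂ (λ b c → 𝟙 (b ∨ c)) (≢mid (inject₁ i)) (≢mid (suc i)))) (sum-replicate-zero j))
                          (cong (λ b → 𝟙 (b ∨ false)) (≢mid (fromℕ j)))))
    where
    ≢mid : ∀ s → does (mid e t ≟V mid e′ s) ≡ false
    ≢mid s = dec-false (mid e t ≟V mid e′ s) (λ { refl → e′≢e refl })

  deg-mid : ∀ e t → deg (mid e t) ≡ 2
  deg-mid e t = trans (deg≡∑ (mid e t)) (trans (∑-delta e (λ _ → incidence-mid-other-path t)) (incidence-mid-own-path e t))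

  radicand : Vertex × Vertex → ℕ
  radicand (a , b) = deg a * deg a + deg b * deg b

  endTerm : (ℕ → ℕ) → Fin n → ℕ
  endTerm φ x = φ (degree G x * degree G x + 4)

  sombor-path : (φ : ℕ → ℕ) (e : Fin m) →
    sum (map (φ ∘ radicand) (path e)) ≡ j * φ 8 + (endTerm φ (proj₁ (ends e)) + endTerm φ (proj₂ (ends e)))
  sombor-path φ e = trans (sum-map-path (φ ∘ radicand) e)
    (trans (cong₂ _+_ (cong φ (radicand≡ (deg-orig u) (deg-mid e zero)))
                      (cong₂ _+_ (trans (sum-cong-≗ (λ i → cong φ (radicand≡ (deg-mid e (inject₁ i)) (deg-mid e (suc i)))))
                                        (∑-const j (φ 8)))
                                 (cong φ (trans (radicand≡ (deg-mid e (fromℕ j)) (deg-orig v)) (+-comm 4 _)))))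
           (x∙yz≈y∙xz (endTerm φ u) (j * φ 8) (endTerm φ v)))
    where
    u v : Fin n
    u = proj₁ (ends e)
    v = proj₂ (ends e)
    radicand≡ : ∀ {a b c d} → deg a ≡ c → deg b ≡ d → radicand (a , b) ≡ c * c + d * d
    radicand≡ = cong₂ (λ c d → c * c + d * d)

  sombor-sum : (φ : ℕ → ℕ) →
    sum (map φ (somborSubdiv G (suc (suc j)))) ≡ m * j * φ 8 + ∑[ x < n ] (degree G x * endTerm φ x)
  sombor-sum φ = begin
    sum (map φ (somborSubdiv G (suc (suc j))))
      ≡⟨ cong sum (map-∘ (subdivEdges G (suc (suc j)))) ⟨
    sum (map (φ ∘ radicand) (subdivEdges G (suc (suc j))))
      ≡⟨ sum-map-subdivEdges (φ ∘ radicand) ⟩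
    ∑[ e < m ] sum (map (φ ∘ radicand) (path e))
      ≡⟨ sum-cong-≗ (sombor-path φ) ⟩
    ∑[ e < m ] (j * φ 8 + ends-term e)
      ≡⟨ ∑-distrib-+ (λ _ → j * φ 8) ends-term ⟩
    ∑[ e < m ] (j * φ 8) + ∑ ends-term
      ≡⟨ cong₂ _+_ (trans (∑-const m (j * φ 8)) (sym (*-assoc m j (φ 8))))
                   (trans (sum-map-lookup (λ (u , v) → endTerm φ u + endTerm φ v) (edges G)) (sum-map-edges G (endTerm φ))) ⟩
    m * j * φ 8 + ∑[ x < n ] (degree G x * endTerm φ x)
      ∎
    where
    open ≡-Reasoning
    ends-term : Fin m → ℕ
    ends-term e = endTerm φ (proj₁ (ends e)) + endTerm φ (proj₂ (ends e))

2*m*j*x≡m*j*[2*x] : ∀ m j x → 2 * m * j * x ≡ m * j * (2 * x)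
2*m*j*x≡m*j*[2*x] = solve-∀

somborSubdiv-lowerBound : ∀ {n} (G : Graph n) (δ : ℕ) → (∀ v → δ ≤ degree G v) → ∀ j →
  ((2 * size G * j) ·√ 2) ++ ((n * δ) ·√ (δ * δ + 4)) ≤√ somborSubdiv G (suc (suc j))
somborSubdiv-lowerBound {n} G δ δ≤ j N = begin
  lowerApprox (((2 * m * j) ·√ 2) ++ ((n * δ) ·√ (δ * δ + 4))) N
    ≡⟨ sum-map-·√-++ ⌊ N √_⌋ (2 * m * j) 2 (n * δ) (δ * δ + 4) ⟩
  2 * m * j * ⌊ N √ 2 ⌋ + n * δ * ⌊ N √ (δ * δ + 4) ⌋
    ≤⟨ +-mono-≤ interior-bound end-bound ⟩
  m * j * ⌈ N √ 8 ⌉ + ∑[ x < n ] (degree G x * ⌈ N √ (degree G x * degree G x + 4) ⌉)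
    ≡⟨ sombor-sum ⌈ N √_⌉ ⟨
  upperApprox (somborSubdiv G (suc (suc j))) N
    ∎
  where
  open Subdivision G j using (m; sombor-sum)
  open ≤-Reasoning
  interior-bound : 2 * m * j * ⌊ N √ 2 ⌋ ≤ m * j * ⌈ N √ 8 ⌉
  interior-bound = ≤-trans (≤-reflexive (2*m*j*x≡m*j*[2*x] m j _))
                           (*-monoʳ-≤ (m * j) (≤-trans (*-⌊√⌋≤⌊√⌋ N 2 2) (isqrt≤csqrt (8 * (N * N)))))
  end-bound : n * δ * ⌊ N √ (δ * δ + 4) ⌋ ≤ ∑[ x < n ] (degree G x * ⌈ N √ (degree G x * degree G x + 4) ⌉)
  end-bound = ≤-trans (≤-reflexive (trans (*-assoc n δ _) (sym (∑-const n _))))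
    (∑-mono-≤ (λ x → *-mono-≤ (δ≤ x) (⌊√⌋≤⌈√⌉ N (+-monoˡ-≤ 4 (*-mono-≤ (δ≤ x) (δ≤ x))))))

somborSubdiv-upperBound : ∀ {n} (G : Graph n) (Δ : ℕ) → (∀ v → degree G v ≤ Δ) → ∀ j →
  somborSubdiv G (suc (suc j)) ≤√ ((2 * size G * j) ·√ 2) ++ ((n * Δ) ·√ (Δ * Δ + 4))
somborSubdiv-upperBound {n} G Δ ≤Δ j N = begin
  lowerApprox (somborSubdiv G (suc (suc j))) N
    ≡⟨ sombor-sum ⌊ N √_⌋ ⟩
  m * j * ⌊ N √ 8 ⌋ + ∑[ x < n ] (degree G x * ⌊ N √ (degree G x * degree G x + 4) ⌋)
    ≤⟨ +-mono-≤ interior-bound end-bound ⟩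
  2 * m * j * ⌈ N √ 2 ⌉ + n * Δ * ⌈ N √ (Δ * Δ + 4) ⌉
    ≡⟨ sum-map-·√-++ ⌈ N √_⌉ (2 * m * j) 2 (n * Δ) (Δ * Δ + 4) ⟨
  upperApprox (((2 * m * j) ·√ 2) ++ ((n * Δ) ·√ (Δ * Δ + 4))) N
    ∎
  where
  open Subdivision G j using (m; sombor-sum)
  open ≤-Reasoning
  interior-bound : m * j * ⌊ N √ 8 ⌋ ≤ 2 * m * j * ⌈ N √ 2 ⌉
  interior-bound = ≤-trans (*-monoʳ-≤ (m * j) (⌊√⌋≤*-⌈√⌉ N 2 2))
                           (≤-reflexive (sym (2*m*j*x≡m*j*[2*x] m j _)))
  end-bound : ∑[ x < n ] (degree G x * ⌊ N √ (degree G x * degree G x + 4) ⌋) ≤ n * Δ * ⌈ N √ (Δ * Δ + 4) ⌉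
  end-bound = ≤-trans
    (∑-mono-≤ (λ x → *-mono-≤ (≤Δ x) (⌊√⌋≤⌈√⌉ N (+-monoˡ-≤ 4 (*-mono-≤ (≤Δ x) (≤Δ x))))))
    (≤-reflexive (trans (∑-const n _) (sym (*-assoc n Δ _))))

corollary3p4 : ∀ {n : ℕ} (G : Graph n) (Δ δ : ℕ) →
    IsMaxDegree G Δ → IsMinDegree G δ →
    ∀ (k : ℕ) → 2 ≤ k →
      (((2 * size G * (k ∸ 2)) ·√ 2) ++ ((n * δ) ·√ (δ * δ + 4))) ≤√ somborSubdiv G k
      × somborSubdiv G k ≤√ (((2 * size G * (k ∸ 2)) ·√ 2) ++ ((n * Δ) ·√ (Δ * Δ + 4)))
corollary3p4 G Δ δ (_ , ≤Δ) (_ , δ≤) (suc (suc j)) (s≤s (s≤s _)) =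
  somborSubdiv-lowerBound G δ δ≤ j , somborSubdiv-upperBound G Δ ≤Δ j
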